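{- Let $B=\langle f,\mathrm{supp}(Y),M\rangle$ be a Boolean network with $M$ a local-to-support mode, and $N=\langle g,Y,\mathbf 1_Y\rangle$ a multi-valued network with $B\sim_\psi N$. Suppose that for every $y_i\in Y$, every value $s_{y_i}\in\mathbb N_{y_i}$ and all $w,w'\in\psi^{ -1}(s_{y_i})\subseteq\mathbb B_{\mathrm{supp}(y_i)}$, $w\neq w'$ implies $d(w,w')>\max\{|m|: m\in M\}$. Then equilibrium stability is preserved: for all $w\in\mathrm{dom}\,\psi$ and all $m\in M$, $w_m\neq f_m(w)$ implies $\psi(w)\neq\psi(f_m(w)\cup w_{ -m})$.
   Context: $Y$ is a finite set of integer variables, $y_i$ taking values in $\{0,\dots,L_i\}$; $\mathbb N_W$, $\mathbb B_Z$ denote integer states on $W$ and Boolean states on $Z$; $s_W$ is restriction, $-W$ complement in the whole variable set, states on disjoint variable sets are combined by union. $d(s,s')=\sum_k|s_k-s'_k|$ (Hamming distance on Boolean states). Supports: pairwise disjoint sets $\mathrm{supp}(y)$ of Boolean variables, $\mathrm{supp}(W)=\bigcup_{y\in W}\mathrm{supp}(y)$. A decoding function $\psi$ is a partial map sending Boolean states on $\mathrm{supp}(W)$ to integer states on $W$ with $\psi(w_{\mathrm{supp}(W)})=\psi(w)_W$ for $w\in\mathrm{dom}\,\psi$; $\psi^{ -1}(v)$ is the preimage. A mode $M$ over $\mathrm{supp}(Y)$ is local-to-support if each $m\in M$ is contained in some $\mathrm{supp}(y_i)$. In $\langle g,Y,M\rangle$, $s\xrightarrow{m}_g s'$ iff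 $s'_y=g_y(s)$ for $y\in m$, $s'_y=s_y$ otherwise; $\mathbf 1_Y=\{\{y\}:y\in Y\}$. For a Boolean network $\langle f,X,M\rangle$ with $f:\mathbb B_X\to\mathbb B_X$, $f_m(w)$ is the restriction of $f(w)$ to $m$ and $w\xrightarrow{m}_f w'$ iff $w'=f_m(w)\cup w_{ -m}$. $B\sim_\psi N$ (for $B=\langle f,X,M_X\rangle$, $N=\langle g,Y,M_Y\rangle$) means there is a total $\mu:M_X\to M_Y$ with (1) for $w,w'\in\mathrm{dom}\,\psi$, $w\xrightarrow{m}_f w'\Rightarrow\psi(w)\xrightarrow{\mu(m)}_g\psi(w')$; (2) whenever $\psi(w)=s$ and $s\xrightarrow{n}_g s'$, there exist $w'$, $m$ with $\mu(m)=n$, $\psi(w')=s'$, $w\xrightarrow{m}_f w'$. -}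

module Defs where

open import Data.Nat using (ℕ; zero; suc; _+_; _⊔_; _<_)
open import Data.Fin using (Fin; zero; suc)
open import Data.Bool using (Bool; true; false; if_then_else_; _xor_)
open import Data.Maybe using (Maybe; just; nothing)
open import Data.Product using (Σ; ∃; _×_; _,_; proj₁; proj₂)
open import Relation.Binary.PropositionalEquality using (_≡_)
open import Relation.Nullary using (¬_)

sumFin : (n : ℕ) → (Fin n → ℕ) → ℕ
sumFin zero    a = 0
sumFin (suc n) a = a zero + sumFin n (λ i → a (suc i))

maxFin : (n : ℕ) → (Fin n → ℕ) → ℕ
maxFin zero    a = 0
maxFin (suc n) a = a zero ⊔ maxFin n (λ i → a (suc i))

boolToℕ : Bool → ℕ
boolToℕ true  = 1
boolToℕ false = 0

countFin : (k : ℕ) → (Fin k → Bool) → ℕ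
countFin k p = sumFin k (λ j → boolToℕ (p j))

-- Setting.
--   Y = {y_0, …, y_{n-1}}, y_i takes values in {0,…,L i}  (Fin (suc (L i))).
--   supp(y_i) = {i} × Fin (k i)  (pairwise disjoint by construction),
--   supp(Y) = Σ (Fin n) (Fin ∘ k).

module Setting (n : ℕ) (L : Fin n → ℕ) (k : Fin n → ℕ) where

  BVar : Set
  BVar = Σ (Fin n) (λ i → Fin (k i))

  BState : Set
  BState = BVar → Bool

  LocBState : Fin n → Set
  LocBState i = Fin (k i) → Bool

  IState : Set
  IState = (i : Fin n) → Fin (suc (L i))

  restrict : BState → (i : Fin n) → LocBState i
  restrict w i j = w (i , j)

  _≈B_ : BState → BState → Set
  w ≈B w' = ∀ x → w x ≡ w' x

  _≈L_ : ∀ {i} → LocBState i → LocBState i → Set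
  u ≈L u' = ∀ j → u j ≡ u' j

  _≈I_ : IState → IState → Set
  s ≈I s' = ∀ i → s i ≡ s' i

  dist : ∀ {i} → LocBState i → LocBState i → ℕ
  dist {i} u u' = countFin (k i) (λ j → u j xor u' j)

  -- A mode over supp(Y): a set of subsets of supp(Y), given as a finite
  -- family of Boolean predicates (membership indicator) indexed by Fin r.
  Mode : ℕ → Set
  Mode r = Fin r → BVar → Bool

  card : (BVar → Bool) → ℕ
  card m = sumFin n (λ i → countFin (k i) (λ j → m (i , j)))

  maxCard : ∀ {r} → Mode r → ℕ
  maxCard {r} M = maxFin r (λ a → card (M a))

  LocalToSupport : ∀ {r} → Mode r → Set
  LocalToSupport {r} M =
    ∀ a → ∃ λ (i : Fin n) → ∀ (x : BVar) → M a x ≡ true → proj₁ x ≡ i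

  update : (BState → BState) → (BVar → Bool) → BState → BState
  update f m w x = if m x then f w x else w x

  BStep : (BState → BState) → (BVar → Bool) → BState → BState → Set
  BStep f m w w' = w' ≈B update f m w

  ChangesOn : (BState → BState) → (BVar → Bool) → BState → Set
  ChangesOn f m w = ¬ (∀ x → m x ≡ true → w x ≡ f w x)

  -- s →{y_i}_g s'   (asynchronous mode 1_Y, block {y_i} identified with i)
  IStep : (IState → IState) → Fin n → IState → IState → Set
  IStep g i s s' = (s' i ≡ g s i) × (∀ j → ¬ (j ≡ i) → s' j ≡ s j)

  record Decoding : Set where
    field
      dec    : BState → Maybe IState
      decLoc : (i : Fin n) → LocBState i → Maybe (Fin (suc (L i)))
      compat : ∀ w s → dec w ≡ just s → ∀ i → decLoc i (restrict w i) ≡ just (s i)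

  _↦_ : Decoding → BState → IState → Set
  (ψ ↦ w) s = ∃ λ s₀ → (Decoding.dec ψ w ≡ just s₀) × (s₀ ≈I s)

  Simulates : (f : BState → BState) → ∀ {r} → Mode r → Decoding →
              (g : IState → IState) → Set
  Simulates f {r} M ψ g =
    ∃ λ (μ : Fin r → Fin n) →
      (∀ w w' s s' a → (ψ ↦ w) s → (ψ ↦ w') s' →
         BStep f (M a) w w' → IStep g (μ a) s s')
      × (∀ w s i s' → (ψ ↦ w) s → IStep g i s s' →
         ∃ λ w' → ∃ λ a → (μ a ≡ i) × (ψ ↦ w') s' × BStep f (M a) w w')

  SeparatedPreimages : Decoding → ℕ → Set
  SeparatedPreimages ψ D =
    ∀ (i : Fin n) (v : Fin (suc (L i))) (u u' : LocBState i) →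
      Decoding.decLoc ψ i u ≡ just v → Decoding.decLoc ψ i u' ≡ just v →
      ¬ (u ≈L u') → D < dist u u'

module Submission where

open import Defs
open import Data.Nat using (ℕ; suc; zero; _≤_; _<_; z≤n; s≤s)
open import Data.Nat.Properties
  using (≤-trans; m≤m+n; m≤n+m; +-mono-≤; m≤m⊔n; m≤n⊔m; <⇒≱)
open import Data.Fin using (Fin; zero; suc)
open import Data.Bool using (true; false; if_then_else_; _xor_)
open import Data.Maybe using (just)
open import Data.Product using (_,_; proj₁; proj₂)
open import Relation.Binary.PropositionalEquality using (_≡_; refl; sym; trans; cong)
open import Relation.Nullary using (¬_)

-- An update along a block m flips at most |m| ≤ max |m| bits of any supp(y_i).
-- If m lies inside supp(y_i) and changes w, the restrictions of w and of its
-- update to supp(y_i) differ, so by separation they cannot decode to the same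
-- value: they would have to be more than max |m| apart.

sumFin-mono : ∀ m {a b : Fin m → ℕ} → (∀ j → a j ≤ b j) → sumFin m a ≤ sumFin m b
sumFin-mono zero    a≤b = z≤n
sumFin-mono (suc m) a≤b = +-mono-≤ (a≤b zero) (sumFin-mono m (λ j → a≤b (suc j)))

≤-sumFin : ∀ m (a : Fin m → ℕ) j → a j ≤ sumFin m a
≤-sumFin (suc m) a zero    = m≤m+n _ _
≤-sumFin (suc m) a (suc j) = ≤-trans (≤-sumFin m _ j) (m≤n+m _ _)

≤-maxFin : ∀ m (a : Fin m → ℕ) j → a j ≤ maxFin m a
≤-maxFin (suc m) a zero    = m≤m⊔n _ _
≤-maxFin (suc m) a (suc j) = ≤-trans (≤-maxFin m _ j) (m≤n⊔m _ _)

xor-if-≤ : ∀ b c d → boolToℕ (c xor (if b then d else c)) ≤ boolToℕ b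
xor-if-≤ true  c     d     = xor-≤-1 c d
  where
    xor-≤-1 : ∀ c d → boolToℕ (c xor d) ≤ 1
    xor-≤-1 true  true  = z≤n
    xor-≤-1 true  false = s≤s z≤n
    xor-≤-1 false true  = s≤s z≤n
    xor-≤-1 false false = z≤n
xor-if-≤ false true  d     = z≤n
xor-if-≤ false false d     = z≤n

module Blocks (n : ℕ) (L k : Fin n → ℕ) where
  open Setting n L k

  dist-update≤card : ∀ f m w i → dist (restrict w i) (restrict (update f m w) i) ≤ card m
  dist-update≤card f m w i =
    ≤-trans (sumFin-mono (k i) (λ j → xor-if-≤ (m (i , j)) (w (i , j)) (f w (i , j))))
            (≤-sumFin n (λ i′ → countFin (k i′) (λ j → m (i′ , j))) i)

  card≤maxCard : ∀ {r} (M : Mode r) a → card (M a) ≤ maxCard M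
  card≤maxCard {r} M = ≤-maxFin r (λ a → card (M a))

  restrict-update-≉ : ∀ f m w i → (∀ x → m x ≡ true → proj₁ x ≡ i) →
                      ChangesOn f m w → ¬ (restrict w i ≈L restrict (update f m w) i)
  restrict-update-≉ f m w i m⊆i changes w≈w′ = changes unchanged
    where
      unchanged : ∀ x → m x ≡ true → w x ≡ f w x
      unchanged (i′ , j) mx with m⊆i (i′ , j) mx
      ... | refl with m (i′ , j) | w≈w′ j
      ...   | true | wx≡fwx = wx≡fwx

  decLoc-restrict : ∀ ψ w {s} → (ψ ↦ w) s → ∀ i →
                    Decoding.decLoc ψ i (restrict w i) ≡ just (s i)
  decLoc-restrict ψ w (s₀ , dec≡s₀ , s₀≈s) i =
    trans (Decoding.compat ψ w s₀ dec≡s₀ i) (cong just (s₀≈s i))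

  ↦-resp-≈I : ∀ ψ w {s s′} → (ψ ↦ w) s → s ≈I s′ → (ψ ↦ w) s′
  ↦-resp-≈I ψ w (s₀ , dec≡s₀ , s₀≈s) s≈s′ = s₀ , dec≡s₀ , λ i → trans (s₀≈s i) (s≈s′ i)

proposition2 : (n : ℕ) (L : Fin n → ℕ) (k : Fin n → ℕ) (r : ℕ) →
    let open Setting n L k in
    (f : BState → BState) (M : Mode r) (g : IState → IState) (ψ : Decoding) →
    LocalToSupport M →
    Simulates f M ψ g →
    SeparatedPreimages ψ (maxCard M) →
    ∀ (w : BState) (s : IState) (a : Fin r) → (ψ ↦ w) s →
    ChangesOn f (M a) w →
    ∀ (s' : IState) → (ψ ↦ update f (M a) w) s' → ¬ (s ≈I s')
proposition2 n L k r f M g ψ local _ separated w s a ψw≡s changes s′ ψw′≡s′ s≈s′ =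
  <⇒≱ far near
  where
    open Setting n L k
    open Blocks n L k
    i : Fin n
    i = proj₁ (local a)
    w′ : BState
    w′ = update f (M a) w
    near : dist (restrict w i) (restrict w′ i) ≤ maxCard M
    near = ≤-trans (dist-update≤card f (M a) w i) (card≤maxCard M a)
    far : maxCard M < dist (restrict w i) (restrict w′ i)
    far = separated i (s i) _ _
            (decLoc-restrict ψ w ψw≡s i)
            (decLoc-restrict ψ w′ (↦-resp-≈I ψ w′ ψw′≡s′ (λ j → sym (s≈s′ j))) i)
            (restrict-update-≉ f (M a) w i (proj₂ (local a)) changes)
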